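{- Let $R$ be the ring of all $3\times 3$ matrices over $GF(2)$ of the form $$M(a,b,c,d)=\begin{pmatrix} a & c & d\\ 0 & b & 0\\ 0 & 0 & b\end{pmatrix},\qquad a,b,c,d\in GF(2),$$ with ordinary matrix addition and multiplication (a non-commutative ring of order $16$ with unity). Write $3=M(0,0,1,0)$, $5=M(0,0,1,1)$, $6=M(0,0,0,1)$, $8=M(0,1,0,0)$, $11=M(0,1,1,0)$, $13=M(0,1,1,1)$, $14=M(0,1,0,1)$. Then the free left $R$-module $R^2$ contains exactly nine distinct free cyclic submodules generated by nonunimodular vectors, namely $$R(3,8),\ R(5,8),\ R(6,8),\ R(8,11),\ R(8,13),\ R(8,14),\ R(8,6),\ R(8,5),\ R(8,3).$$
   Context: For $(a,b)\in R^2$, the cyclic submodule generated by $(a,b)$ is $R(a,b)=\{(\alpha a,\alpha b):\alpha\in R\}$. It is called free if the map $\alpha\mapsto(\alpha a,\alpha b)$ from $R$ to $R^2$ is injective. A vector $(a,b)\in R^2$ is called unimodular if there exist $c,d\in R$ with $ac+bd=1$, and nonunimodular otherwise. -}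

module Defs where

open import Data.Bool using (Bool; true; false; _xor_; _∧_)
open import Data.Fin using (Fin; zero; suc)
open import Data.Product using (Σ; ∃; _×_; _,_; proj₁; proj₂)
open import Data.Vec using (Vec; []; _∷_; lookup)
open import Relation.Binary.PropositionalEquality using (_≡_)
open import Relation.Nullary using (¬_)
open import Function.Definitions using (Injective)

-- GF(2) is modelled by Bool with addition _xor_ and multiplication _∧_.

Mat3 : Set
Mat3 = Fin 3 → Fin 3 → Bool

_·ₘ_ : Mat3 → Mat3 → Mat3
(A ·ₘ B) i j = ((A i zero ∧ B zero j) xor (A i (suc zero) ∧ B (suc zero) j))
               xor (A i (suc (suc zero)) ∧ B (suc (suc zero)) j)

data R : Set where
  M : (a b c d : Bool) → R

toMat : R → Mat3
toMat (M a b c d) zero zero = a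
toMat (M a b c d) zero (suc zero) = c
toMat (M a b c d) zero (suc (suc zero)) = d
toMat (M a b c d) (suc zero) (suc zero) = b
toMat (M a b c d) (suc (suc zero)) (suc (suc zero)) = b
toMat (M a b c d) _ _ = false

fromMat : Mat3 → R
fromMat X = M (X zero zero) (X (suc zero) (suc zero)) (X zero (suc zero)) (X zero (suc (suc zero)))

-- ring operations: ordinary matrix addition and multiplication
-- (R is closed under matrix product, so fromMat loses nothing here)
_+R_ : R → R → R
M a b c d +R M a' b' c' d' = M (a xor a') (b xor b') (c xor c') (d xor d')

_*R_ : R → R → R
x *R y = fromMat (toMat x ·ₘ toMat y)

0R 1R : R
0R = M false false false false
1R = M true true false false

r3 r5 r6 r8 r11 r13 r14 : R
r3  = M false false true  false
r5  = M false false true  true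
r6  = M false false false true
r8  = M false true  false false
r11 = M false true  true  false
r13 = M false true  true  true
r14 = M false true  false true

R² : Set
R² = R × R

Unimodular : R² → Set
Unimodular (a , b) = ∃ λ c → ∃ λ d → (a *R c) +R (b *R d) ≡ 1R

NonUnimodular : R² → Set
NonUnimodular v = ¬ Unimodular v

_∈R_ : R² → R² → Set
w ∈R (a , b) = ∃ λ α → w ≡ (α *R a , α *R b)

Free : R² → Set
Free (a , b) = Injective _≡_ _≡_ mapAB
  where
  mapAB : R → R²
  mapAB α = (α *R a , α *R b)

SameSubmodule : R² → R² → Set
SameSubmodule u v = ∀ w → (w ∈R u → w ∈R v) × (w ∈R v → w ∈R u)

listed : Vec R² 9
listed = (r3 , r8) ∷ (r5 , r8) ∷ (r6 , r8) ∷ (r8 , r11) ∷ (r8 , r13) ∷ (r8 , r14)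
       ∷ (r8 , r6) ∷ (r8 , r5) ∷ (r8 , r3) ∷ []

-- R has only sixteen elements, so every notion in the statement is decided by exhaustive
-- search once it is brought into finite form.  Two reductions keep the search small: R u and
-- R v coincide iff u ∈ R v and v ∈ R u (R has a unit and is associative), and R(a,b) is free
-- iff no nonzero α annihilates both a and b (α a = β a gives (α + β) a = 0 in characteristic 2).
module Submission where

open import Defs
open import Data.Fin using (Fin)
open import Data.Vec using (lookup)
open import Data.Product using (∃; _×_)
open import Relation.Binary.PropositionalEquality using (_≡_)

open import Data.Bool using (Bool; true; false)
import Data.Bool.Properties as Bool
open import Data.Fin.Properties using (all?; any?) renaming (_≟_ to _≟ᶠ_)
open import Data.Product using (_,_; proj₁; proj₂)
open import Data.Product.Properties using (≡-dec)
open import Data.Sum using (inj₁; inj₂)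
open import Level using (Level)
open import Relation.Binary.Definitions using (DecidableEquality)
open import Relation.Binary.PropositionalEquality using (refl; sym; trans; cong; cong₂; module ≡-Reasoning)
open import Relation.Nullary using (Dec; ¬?; _×-dec_; _⊎-dec_; _→-dec_)
open import Relation.Nullary.Decidable using (map′; from-yes)
open import Relation.Unary using (Decidable)

private
  variable
    p : Level

∀-Bool? : {P : Bool → Set p} → Decidable P → Dec (∀ x → P x)
∀-Bool? P? = map′ (λ (f , t) → λ { false → f ; true → t }) (λ h → h false , h true)
                  (P? false ×-dec P? true)

∃-Bool? : {P : Bool → Set p} → Decidable P → Dec (∃ P)
∃-Bool? P? = map′ (λ { (inj₁ f) → false , f ; (inj₂ t) → true , t })
                  (λ { (false , f) → inj₁ f ; (true , t) → inj₂ t })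
                  (P? false ⊎-dec P? true)

∀-R? : {P : R → Set p} → Decidable P → Dec (∀ x → P x)
∀-R? P? = map′ (λ h → λ { (M a b c d) → h a b c d }) (λ h a b c d → h (M a b c d))
               (∀-Bool? λ a → ∀-Bool? λ b → ∀-Bool? λ c → ∀-Bool? λ d → P? (M a b c d))

∃-R? : {P : R → Set p} → Decidable P → Dec (∃ P)
∃-R? P? = map′ (λ (a , b , c , d , x) → M a b c d , x) (λ { (M a b c d , x) → a , b , c , d , x })
               (∃-Bool? λ a → ∃-Bool? λ b → ∃-Bool? λ c → ∃-Bool? λ d → P? (M a b c d))

∀-R²? : {P : R² → Set p} → Decidable P → Dec (∀ v → P v)
∀-R²? P? = map′ (λ h (a , b) → h a b) (λ h a b → h (a , b)) (∀-R? λ a → ∀-R? λ b → P? (a , b))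

_≟_ : DecidableEquality R
M a b c d ≟ M a′ b′ c′ d′ =
  map′ (λ { (refl , refl , refl , refl) → refl }) (λ { refl → refl , refl , refl , refl })
       (a Bool.≟ a′ ×-dec b Bool.≟ b′ ×-dec c Bool.≟ c′ ×-dec d Bool.≟ d′)

_≟²_ : DecidableEquality R²
_≟²_ = ≡-dec _≟_ _≟_

*R-assoc : ∀ x y z → (x *R y) *R z ≡ x *R (y *R z)
*R-assoc = from-yes (∀-R? λ x → ∀-R? λ y → ∀-R? λ z → ((x *R y) *R z) ≟ (x *R (y *R z)))

*R-identityˡ : ∀ x → 1R *R x ≡ x
*R-identityˡ = from-yes (∀-R? λ x → (1R *R x) ≟ x)

*R-zeroˡ : ∀ x → 0R *R x ≡ 0R
*R-zeroˡ = from-yes (∀-R? λ x → (0R *R x) ≟ 0R)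

*R-distribʳ-+R : ∀ x y z → (y +R z) *R x ≡ (y *R x) +R (z *R x)
*R-distribʳ-+R = from-yes (∀-R? λ x → ∀-R? λ y → ∀-R? λ z → ((y +R z) *R x) ≟ ((y *R x) +R (z *R x)))

+R-self : ∀ x → x +R x ≡ 0R
+R-self = from-yes (∀-R? λ x → (x +R x) ≟ 0R)

+R-cancel : ∀ x y → x +R y ≡ 0R → x ≡ y
+R-cancel = from-yes (∀-R? λ x → ∀-R? λ y → ((x +R y) ≟ 0R) →-dec (x ≟ y))

_⊆R_ : R² → R² → Set
u ⊆R v = ∀ w → w ∈R u → w ∈R v

∈R-refl : ∀ v → v ∈R v
∈R-refl (a , b) = 1R , sym (cong₂ _,_ (*R-identityˡ a) (*R-identityˡ b))

∈R⇒⊆R : ∀ u v → u ∈R v → u ⊆R v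
∈R⇒⊆R (a , b) (c , d) (β , refl) w (α , refl) =
  α *R β , sym (cong₂ _,_ (*R-assoc α β c) (*R-assoc α β d))

SameSubmodule⇔mutual-∈R : ∀ u v → (SameSubmodule u v → u ∈R v × v ∈R u)
                                 × (u ∈R v × v ∈R u → SameSubmodule u v)
SameSubmodule⇔mutual-∈R u v =
  (λ same → proj₁ (same u) (∈R-refl u) , proj₂ (same v) (∈R-refl v))
  , λ (u∈v , v∈u) w → ∈R⇒⊆R u v u∈v w , ∈R⇒⊆R v u v∈u w

_∈R?_ : ∀ w v → Dec (w ∈R v)
w ∈R? (a , b) = ∃-R? λ α → w ≟² (α *R a , α *R b)

SameSubmodule? : ∀ u v → Dec (SameSubmodule u v)
SameSubmodule? u v = map′ (proj₂ (SameSubmodule⇔mutual-∈R u v)) (proj₁ (SameSubmodule⇔mutual-∈R u v))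
                          (u ∈R? v ×-dec v ∈R? u)

Unimodular? : ∀ v → Dec (Unimodular v)
Unimodular? (a , b) = ∃-R? λ c → ∃-R? λ d → ((a *R c) +R (b *R d)) ≟ 1R

TrivialAnnihilator : R² → Set
TrivialAnnihilator (a , b) = ∀ α → α *R a ≡ 0R → α *R b ≡ 0R → α ≡ 0R

Free⇒TrivialAnnihilator : ∀ v → Free v → TrivialAnnihilator v
Free⇒TrivialAnnihilator (a , b) inj α αa≡0 αb≡0 =
  inj (cong₂ _,_ (trans αa≡0 (sym (*R-zeroˡ a))) (trans αb≡0 (sym (*R-zeroˡ b))))

TrivialAnnihilator⇒Free : ∀ v → TrivialAnnihilator v → Free v
TrivialAnnihilator⇒Free (a , b) ann {α} {β} αv≡βv =
  +R-cancel α β (ann (α +R β) (kills a (cong proj₁ αv≡βv)) (kills b (cong proj₂ αv≡βv)))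
  where
  kills : ∀ x → α *R x ≡ β *R x → (α +R β) *R x ≡ 0R
  kills x αx≡βx = begin
    (α +R β) *R x          ≡⟨ *R-distribʳ-+R x α β ⟩
    (α *R x) +R (β *R x)   ≡⟨ cong (_+R (β *R x)) αx≡βx ⟩
    (β *R x) +R (β *R x)   ≡⟨ +R-self (β *R x) ⟩
    0R                     ∎
    where open ≡-Reasoning

TrivialAnnihilator? : ∀ v → Dec (TrivialAnnihilator v)
TrivialAnnihilator? (a , b) = ∀-R? λ α → ((α *R a) ≟ 0R) →-dec (((α *R b) ≟ 0R) →-dec (α ≟ 0R))

Free? : ∀ v → Dec (Free v)
Free? v = map′ (TrivialAnnihilator⇒Free v) (Free⇒TrivialAnnihilator v) (TrivialAnnihilator? v)

listed-nonunimodular-free : ∀ k → NonUnimodular (lookup listed k) × Free (lookup listed k)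
listed-nonunimodular-free = from-yes (all? λ k →
  ¬? (Unimodular? (lookup listed k)) ×-dec Free? (lookup listed k))

listed-distinct : ∀ i j → SameSubmodule (lookup listed i) (lookup listed j) → i ≡ j
listed-distinct = from-yes (all? λ i → all? λ j →
  SameSubmodule? (lookup listed i) (lookup listed j) →-dec (i ≟ᶠ j))

listed-complete : ∀ v → NonUnimodular v → Free v → ∃ λ k → SameSubmodule v (lookup listed k)
listed-complete = from-yes (∀-R²? λ v →
  ¬? (Unimodular? v) →-dec (Free? v →-dec any? λ k → SameSubmodule? v (lookup listed k)))

mainTheorem1 :
    -- each listed generator is nonunimodular and generates a free cyclic submodule
    (∀ (k : Fin 9) → NonUnimodular (lookup listed k) × Free (lookup listed k))
    -- the nine listed submodules are pairwise distinct
    × (∀ (i j : Fin 9) → SameSubmodule (lookup listed i) (lookup listed j) → i ≡ j)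
    -- every free cyclic submodule generated by a nonunimodular vector is one of them
    × (∀ (v : R²) → NonUnimodular v → Free v →
         ∃ λ (k : Fin 9) → SameSubmodule v (lookup listed k))
mainTheorem1 = listed-nonunimodular-free , listed-distinct , listed-complete
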